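{- Let $C_n$ be the cycle graph of order $n\ge 3$. For every graph $G$, $$\gamma_o(G\Box C_n)\ge \left\lceil \frac{n\gamma_o(G)}{2}\right\rceil.$$
   Context: All graphs are finite and simple. For a graph with vertex set $V$, a vertex $v$ and $S\subseteq V$, let $\delta_S(v)=|N(v)\cap S|$ and $\overline{S}=V\setminus S$. A nonempty set $S\subseteq V$ is a global offensive alliance if $\delta_S(v)\ge \delta_{\overline{S}}(v)+1$ for every $v\in\overline{S}$; $\gamma_o(G)$ is the minimum cardinality of a global offensive alliance of $G$. $G\Box H$ is the Cartesian product: vertex set $V(G)\times V(H)$, with $(a,b)\sim(c,d)$ iff ($a=c$ and $b\sim d$ in $H$) or ($a\sim c$ in $G$ and $b=d$). -}

module Defs where

open import Data.Nat using (ℕ; suc; _+_; _*_; _≤_; _/_; _%_; NonZero)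
import Data.Nat as ℕ
open import Data.Bool using (Bool; true; false; _∧_; _∨_)
open import Data.Fin using (Fin; remQuot; toℕ)
import Data.Fin as F
open import Data.Fin.Subset using (Subset; _∈_; _∉_; ∣_∣; _∩_; ∁; Nonempty)
open import Data.Vec using (tabulate)
open import Data.Product using (Σ; _×_; _,_)
open import Relation.Binary.PropositionalEquality using (_≡_)
open import Relation.Nullary.Decidable using (⌊_⌋)

record Graph : Set where
  constructor mkGraph
  field
    order : ℕ
    adj   : Fin order → Fin order → Bool
open Graph public

IsSimple : Graph → Set
IsSimple G = (∀ u v → adj G u v ≡ adj G v u) × (∀ v → adj G v v ≡ false)

N : (G : Graph) → Fin (order G) → Subset (order G)
N G v = tabulate (adj G v)

δ : (G : Graph) → Subset (order G) → Fin (order G) → ℕ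
δ G S v = ∣ N G v ∩ S ∣

IsGOA : (G : Graph) → Subset (order G) → Set
IsGOA G S = Nonempty S × (∀ v → v ∉ S → δ G (∁ S) v + 1 ≤ δ G S v)

IsGammaO : (G : Graph) → ℕ → Set
IsGammaO G k = Σ (Subset (order G)) (λ S → IsGOA G S × ∣ S ∣ ≡ k)
             × (∀ S → IsGOA G S → k ≤ ∣ S ∣)

-- the cycle C_n on vertices 0..n-1: i ~ j iff j ≡ i+1 or i ≡ j+1 (mod n)
-- (simple whenever n ≥ 3)
cycleAdj : (n : ℕ) → Fin n → Fin n → Bool
cycleAdj (suc m) i j =
  ⌊ ((toℕ i + 1) % suc m) ℕ.≟ toℕ j ⌋ ∨ ⌊ ((toℕ j + 1) % suc m) ℕ.≟ toℕ i ⌋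

Cycle : ℕ → Graph
Cycle n = mkGraph n (cycleAdj n)

boxAdj : (G H : Graph) → Fin (order G ℕ.* order H) → Fin (order G ℕ.* order H) → Bool
boxAdj G H x y with remQuot (order H) x | remQuot (order H) y
... | a , b | c , d = (⌊ a F.≟ c ⌋ ∧ adj H b d) ∨ (adj G a c ∧ ⌊ b F.≟ d ⌋)

_□_ : Graph → Graph → Graph
G □ H = mkGraph (order G ℕ.* order H) (boxAdj G H)

ceilHalf : ℕ → ℕ
ceilHalf m = (m + 1) / 2

-- Let S be a minimum global offensive alliance of G □ Cₙ and Sᵢ ⊆ V(G) its layer over the
-- cycle vertex i. If v ∉ Sᵢ ∪ Sᵢ₊₁, the vertex (v, i) ∉ S has its cycle neighbour (v, i+1)
-- outside S and at most one cycle neighbour, (v, i-1), inside S, so the alliance inequality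
-- at (v, i) in G □ Cₙ yields the one at v in G for Sᵢ, hence for Sᵢ ∪ Sᵢ₊₁. Thus every
-- Sᵢ ∪ Sᵢ₊₁ is a global offensive alliance of G, and summing γₒ(G) ≤ |Sᵢ| + |Sᵢ₊₁| over the
-- n layers gives n γₒ(G) ≤ 2|S|.
module Submission where

open import Defs
open import Data.Nat using (ℕ; zero; suc; _+_; _*_; _≤_; _<_; z≤n; s≤s; s≤s⁻¹; _%_)
import Data.Nat as ℕ
open import Data.Nat.Properties
  using (+-0-commutativeMonoid; +-comm; +-assoc; +-suc; +-identityʳ; *-comm; ≤-trans; ≤-reflexive; >⇒≢;
         m≤n+m; +-mono-≤; +-monoˡ-≤; +-monoʳ-≤; +-cancelʳ-≤; module ≤-Reasoning)
open import Data.Nat.DivMod using (m%n<n; m<n⇒m%n≡m; n%n≡0; m<n*o⇒m/o<n)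
open import Algebra.Properties.CommutativeMonoid.Sum +-0-commutativeMonoid
  using (sum; sum-syntax; sum-cong-≗; sum-remove; sum-replicate-zero; sum-init-last; ∑-distrib-+; ∑-comm)
open import Data.Bool using (Bool; true; false; _∧_; _∨_; not)
open import Data.Bool.Properties using (∧-assoc; ∧-comm; ∧-zeroʳ)
open import Data.Fin using (Fin; zero; suc; toℕ; combine; _↑ˡ_; _↑ʳ_; fromℕ<; inject₁; fromℕ; punchIn)
import Data.Fin as F
open import Data.Fin.Properties using (remQuot-combine; 0≢1+n; toℕ-injective; toℕ-fromℕ<; toℕ-inject₁; toℕ-fromℕ; toℕ<n; punchInᵢ≢i)
  renaming (suc-injective to Fin-suc-injective)
open import Data.Fin.Relation.Unary.Top using (view; ‵fromℕ; ‵inject₁)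
open import Data.Fin.Subset using (Subset; _∈_; _∉_; _⊆_; ∣_∣; _∩_; _∪_; ∁; Nonempty; Empty)
open import Data.Fin.Subset.Properties
  using (_∈?_; nonempty?; Empty-unique; ∣⊥∣≡0; ∣p∣≤∣x∷p∣; p⊆q⇒∣p∣≤∣q∣; x∈p⇒∣p-x∣<∣p∣;
         x∈p∩q⁺; x∈p∩q⁻; x∈p∪q⁺; p⊆p∪q; p⊆q⇒∁p⊇∁q; x∉p⇒x∈∁p)
open import Data.Vec using ([]; _∷_; here; there; lookup; tabulate)
open import Data.Vec.Properties using (lookup∘tabulate; tabulate∘lookup; lookup-map; lookup-zipWith; []=⇒lookup; lookup⇒[]=; tabulate-cong; tabulate-∘)
open import Data.Product using (_×_; _,_; proj₂)
open import Data.Sum using (_⊎_; inj₁; inj₂)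
open import Function using (_∘_)
open import Relation.Binary.PropositionalEquality
open import Relation.Nullary using (yes; no; contradiction)
open import Relation.Nullary.Decidable using (⌊_⌋)

𝟙 : Bool → ℕ
𝟙 true  = 1
𝟙 false = 0

∑-const : ∀ n c → ∑[ i < n ] c ≡ n * c
∑-const zero    c = refl
∑-const (suc n) c = cong (c +_) (∑-const n c)

∑-mono-≤ : ∀ {n} {f g : Fin n → ℕ} → (∀ i → f i ≤ g i) → sum f ≤ sum g
∑-mono-≤ {zero}  f≤g = z≤n
∑-mono-≤ {suc n} f≤g = +-mono-≤ (f≤g zero) (∑-mono-≤ (f≤g ∘ suc))

∑-single : ∀ {n} (f : Fin n → ℕ) i → (∀ j → j ≢ i → f j ≡ 0) → sum f ≡ f i
∑-single {suc n} f i f≡0 = begin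
  sum f                             ≡⟨ sum-remove {i = i} f ⟩
  f i + ∑[ j < n ] f (punchIn i j)  ≡⟨ cong (f i +_) (sum-cong-≗ (λ j → f≡0 (punchIn i j) (punchInᵢ≢i i j))) ⟩
  f i + ∑[ j < n ] 0                ≡⟨ cong (f i +_) (sum-replicate-zero n) ⟩
  f i + 0                           ≡⟨ +-identityʳ (f i) ⟩
  f i                               ∎
  where open ≡-Reasoning

∑-Kronecker : ∀ {n} (i : Fin n) (f : Fin n → Bool) → ∑[ j < n ] 𝟙 (⌊ i F.≟ j ⌋ ∧ f j) ≡ 𝟙 (f i)
∑-Kronecker i f = trans (∑-single _ i off-diagonal) (cong (λ b → 𝟙 (b ∧ f i)) (on-diagonal (i F.≟ i)))
  where
  off-diagonal : ∀ j → j ≢ i → 𝟙 (⌊ i F.≟ j ⌋ ∧ f j) ≡ 0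
  off-diagonal j j≢i with i F.≟ j
  ... | yes i≡j = contradiction (sym i≡j) j≢i
  ... | no _    = refl
  on-diagonal : ∀ d → ⌊ d ⌋ ≡ true
  on-diagonal (yes _)  = refl
  on-diagonal (no i≢i) = contradiction refl i≢i

∑-↑ : ∀ m {n} (f : Fin (m + n) → ℕ) → sum f ≡ ∑[ i < m ] f (i ↑ˡ n) + ∑[ j < n ] f (m ↑ʳ j)
∑-↑ zero    f = refl
∑-↑ (suc m) f = trans (cong (f zero +_) (∑-↑ m (f ∘ suc))) (sym (+-assoc (f zero) _ _))

∑-combine : ∀ m {n} (f : Fin (m * n) → ℕ) → sum f ≡ ∑[ a < m ] ∑[ b < n ] f (combine a b)
∑-combine zero        f = refl
∑-combine (suc m) {n} f = trans (∑-↑ n f) (cong (∑[ b < n ] f (b ↑ˡ m * n) +_) (∑-combine m (f ∘ (n ↑ʳ_))))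

∣p∣≡∑𝟙 : ∀ {n} (p : Subset n) → ∣ p ∣ ≡ ∑[ x < n ] 𝟙 (lookup p x)
∣p∣≡∑𝟙 []          = refl
∣p∣≡∑𝟙 (true ∷ p)  = cong suc (∣p∣≡∑𝟙 p)
∣p∣≡∑𝟙 (false ∷ p) = ∣p∣≡∑𝟙 p

∣tabulate∣≡∑𝟙 : ∀ {n} (f : Fin n → Bool) → ∣ tabulate f ∣ ≡ ∑[ x < n ] 𝟙 (f x)
∣tabulate∣≡∑𝟙 f = trans (∣p∣≡∑𝟙 (tabulate f)) (sum-cong-≗ λ x → cong 𝟙 (lookup∘tabulate f x))

∣p∪q∣≤∣p∣+∣q∣ : ∀ {n} (p q : Subset n) → ∣ p ∪ q ∣ ≤ ∣ p ∣ + ∣ q ∣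
∣p∪q∣≤∣p∣+∣q∣ []          []          = z≤n
∣p∪q∣≤∣p∣+∣q∣ (true ∷ p)  (y ∷ q)     = s≤s (≤-trans (∣p∪q∣≤∣p∣+∣q∣ p q) (+-monoʳ-≤ ∣ p ∣ (∣p∣≤∣x∷p∣ y q)))
∣p∪q∣≤∣p∣+∣q∣ (false ∷ p) (true ∷ q)  = subst (suc ∣ p ∪ q ∣ ≤_) (sym (+-suc ∣ p ∣ ∣ q ∣)) (s≤s (∣p∪q∣≤∣p∣+∣q∣ p q))
∣p∪q∣≤∣p∣+∣q∣ (false ∷ p) (false ∷ q) = ∣p∪q∣≤∣p∣+∣q∣ p q

Empty⇒∣p∣≡0 : ∀ {n} {p : Subset n} → Empty p → ∣ p ∣ ≡ 0
Empty⇒∣p∣≡0 {n} p-empty = trans (cong ∣_∣ (Empty-unique p-empty)) (∣⊥∣≡0 n)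

all-equal⇒∣p∣≤1 : ∀ {n} (p : Subset n) → (∀ {x y} → x ∈ p → y ∈ p → x ≡ y) → ∣ p ∣ ≤ 1
all-equal⇒∣p∣≤1 []          _      = z≤n
all-equal⇒∣p∣≤1 (true ∷ p)  unique = s≤s (≤-reflexive (Empty⇒∣p∣≡0 λ (x , x∈p) → 0≢1+n (unique here (there x∈p))))
all-equal⇒∣p∣≤1 (false ∷ p) unique = all-equal⇒∣p∣≤1 p (λ x∈p y∈p → Fin-suc-injective (unique (there x∈p) (there y∈p)))

x∈p⇒0<∣p∣ : ∀ {n x} {p : Subset n} → x ∈ p → 0 < ∣ p ∣
x∈p⇒0<∣p∣ x∈p = ≤-trans (s≤s z≤n) (x∈p⇒∣p-x∣<∣p∣ x∈p)

0<∣p∣⇒Nonempty : ∀ {n} {p : Subset n} → 0 < ∣ p ∣ → Nonempty p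
0<∣p∣⇒Nonempty {p = p} 0<∣p∣ with nonempty? p
... | yes p-nonempty = p-nonempty
... | no  p-empty    = contradiction (Empty⇒∣p∣≡0 p-empty) (>⇒≢ 0<∣p∣)

∈-tabulate⁺ : ∀ {n} {f : Fin n → Bool} {x} → f x ≡ true → x ∈ tabulate f
∈-tabulate⁺ {f = f} {x} fx = lookup⇒[]= x (tabulate f) (trans (lookup∘tabulate f x) fx)

∈-tabulate⁻ : ∀ {n} {f : Fin n → Bool} {x} → x ∈ tabulate f → f x ≡ true
∈-tabulate⁻ {f = f} {x} x∈ = trans (sym (lookup∘tabulate f x)) ([]=⇒lookup x∈)

δ-tabulate : ∀ G (f : Fin (order G) → Bool) v → δ G (tabulate f) v ≡ ∑[ w < order G ] 𝟙 (adj G v w ∧ f w)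
δ-tabulate G f v = trans (∣p∣≡∑𝟙 (N G v ∩ tabulate f)) (sum-cong-≗ λ w →
  cong 𝟙 (trans (lookup-zipWith _∧_ w (N G v) (tabulate f))
                (cong₂ _∧_ (lookup∘tabulate (adj G v) w) (lookup∘tabulate f w))))

δ≡∑ : ∀ G S v → δ G S v ≡ ∑[ w < order G ] 𝟙 (adj G v w ∧ lookup S w)
δ≡∑ G S v = trans (cong (λ T → δ G T v) (sym (tabulate∘lookup S))) (δ-tabulate G (lookup S) v)

boxAdj-combine : ∀ G H a b c d →
  boxAdj G H (combine a b) (combine c d) ≡ (⌊ a F.≟ c ⌋ ∧ adj H b d) ∨ (adj G a c ∧ ⌊ b F.≟ d ⌋)
boxAdj-combine G H a b c d = cong₂ adjacent (remQuot-combine a b) (remQuot-combine c d)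
  where
  adjacent : Fin (order G) × Fin (order H) → Fin (order G) × Fin (order H) → Bool
  adjacent (a , b) (c , d) = (⌊ a F.≟ c ⌋ ∧ adj H b d) ∨ (adj G a c ∧ ⌊ b F.≟ d ⌋)

δ-mono : ∀ G {p q} v → p ⊆ q → δ G p v ≤ δ G q v
δ-mono G {p} {q} v p⊆q = p⊆q⇒∣p∣≤∣q∣ {p = N G v ∩ p} {q = N G v ∩ q} λ x∈N∩p →
  let x∈N , x∈p = x∈p∩q⁻ (N G v) p x∈N∩p in x∈p∩q⁺ (x∈N , p⊆q x∈p)

Offensive : (G : Graph) → Subset (order G) → Set
Offensive G S = ∀ v → v ∉ S → δ G (∁ S) v + 1 ≤ δ G S v

offensive⇒nonempty : ∀ G {S} → Fin (order G) → Offensive G S → Nonempty S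
offensive⇒nonempty G {S} v S-offensive with v ∈? S
... | yes v∈S = v , v∈S
... | no  v∉S = let w , w∈N∩S = 0<∣p∣⇒Nonempty {p = N G v ∩ S} (≤-trans (m≤n+m 1 _) (S-offensive v v∉S))
                in w , proj₂ (x∈p∩q⁻ (N G v) S w∈N∩S)

module Grid (m n : ℕ) where

  layer : Subset (m * n) → Fin n → Subset m
  layer T b = tabulate λ a → lookup T (combine a b)

  fibre : Subset (m * n) → Fin m → Subset n
  fibre T a = tabulate λ b → lookup T (combine a b)

  layer-∁ : ∀ T b → layer (∁ T) b ≡ ∁ (layer T b)
  layer-∁ T b = trans (tabulate-cong λ a → lookup-map (combine a b) not T) (tabulate-∘ not _)

  fibre-∁ : ∀ T a → fibre (∁ T) a ≡ ∁ (fibre T a)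
  fibre-∁ T a = trans (tabulate-cong λ b → lookup-map (combine a b) not T) (tabulate-∘ not _)

  ∣T∣≡∑∣layer∣ : ∀ T → ∣ T ∣ ≡ ∑[ b < n ] ∣ layer T b ∣
  ∣T∣≡∑∣layer∣ T = begin
    ∣ T ∣                                              ≡⟨ ∣p∣≡∑𝟙 T ⟩
    ∑[ x < m * n ] 𝟙 (lookup T x)                      ≡⟨ ∑-combine m _ ⟩
    ∑[ a < m ] ∑[ b < n ] 𝟙 (lookup T (combine a b))   ≡⟨ ∑-comm (λ (a : Fin m) (b : Fin n) → 𝟙 (lookup T (combine a b))) ⟩
    ∑[ b < n ] ∑[ a < m ] 𝟙 (lookup T (combine a b))   ≡⟨ sum-cong-≗ {n} (λ b → ∣tabulate∣≡∑𝟙 (λ (a : Fin m) → lookup T (combine a b))) ⟨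
    ∑[ b < n ] ∣ layer T b ∣                           ∎
    where open ≡-Reasoning

𝟙-∨ : ∀ x y t → x ∧ y ≡ false → 𝟙 ((x ∨ y) ∧ t) ≡ 𝟙 (x ∧ t) + 𝟙 (y ∧ t)
𝟙-∨ false y     t     _ = refl
𝟙-∨ true  false true  _ = refl
𝟙-∨ true  false false _ = refl

module _ (G H : Graph) where
  open Grid (order G) (order H)

  δ-□ : (∀ a → adj G a a ≡ false) → ∀ T a b →
        δ (G □ H) T (combine a b) ≡ δ G (layer T b) a + δ H (fibre T a) b
  δ-□ loopless T a b = begin
    δ (G □ H) T (combine a b)
      ≡⟨ δ≡∑ (G □ H) T (combine a b) ⟩
    ∑[ x < order G * order H ] 𝟙 (boxAdj G H (combine a b) x ∧ t x)
      ≡⟨ ∑-combine (order G) _ ⟩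
    ∑[ c < order G ] ∑[ d < order H ] 𝟙 (boxAdj G H (combine a b) (combine c d) ∧ t (combine c d))
      ≡⟨ sum-cong-≗ {order G} (λ c → sum-cong-≗ {order H} (split c)) ⟩
    ∑[ c < order G ] ∑[ d < order H ] (inLayer c d + inFibre c d)
      ≡⟨ sum-cong-≗ {order G} (λ c → ∑-distrib-+ (inLayer c) (inFibre c)) ⟩
    ∑[ c < order G ] (∑[ d < order H ] inLayer c d + ∑[ d < order H ] inFibre c d)
      ≡⟨ ∑-distrib-+ (λ c → ∑[ d < order H ] inLayer c d) (λ c → ∑[ d < order H ] inFibre c d) ⟩
    ∑[ c < order G ] ∑[ d < order H ] inLayer c d + ∑[ c < order G ] ∑[ d < order H ] inFibre c d
      ≡⟨ cong (∑[ c < order G ] ∑[ d < order H ] inLayer c d +_) (∑-comm inFibre) ⟩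
    ∑[ c < order G ] ∑[ d < order H ] inLayer c d + ∑[ d < order H ] ∑[ c < order G ] inFibre c d
      ≡⟨ cong₂ _+_ (sum-cong-≗ {order G} λ c → ∑-Kronecker b _) (sum-cong-≗ {order H} λ d → ∑-Kronecker a _) ⟩
    ∑[ c < order G ] 𝟙 (adj G a c ∧ t (combine c b)) + ∑[ d < order H ] 𝟙 (adj H b d ∧ t (combine a d))
      ≡⟨ cong₂ _+_ (δ-tabulate G _ a) (δ-tabulate H _ b) ⟨
    δ G (layer T b) a + δ H (fibre T a) b
      ∎
    where
    open ≡-Reasoning
    t = lookup T
    inLayer inFibre : Fin (order G) → Fin (order H) → ℕ
    inLayer c d = 𝟙 (⌊ b F.≟ d ⌋ ∧ (adj G a c ∧ t (combine c d)))
    inFibre c d = 𝟙 (⌊ a F.≟ c ⌋ ∧ (adj H b d ∧ t (combine c d)))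
    disjoint : ∀ c d → (⌊ a F.≟ c ⌋ ∧ adj H b d) ∧ (adj G a c ∧ ⌊ b F.≟ d ⌋) ≡ false
    disjoint c d with a F.≟ c
    ... | no _     = refl
    ... | yes refl = trans (cong (λ g → adj H b d ∧ (g ∧ ⌊ b F.≟ d ⌋)) (loopless a)) (∧-zeroʳ (adj H b d))
    split : ∀ c d → 𝟙 (boxAdj G H (combine a b) (combine c d) ∧ t (combine c d)) ≡ inLayer c d + inFibre c d
    split c d = begin
      𝟙 (boxAdj G H (combine a b) (combine c d) ∧ s) ≡⟨ cong (λ e → 𝟙 (e ∧ s)) (boxAdj-combine G H a b c d) ⟩
      𝟙 (((e₁ ∧ h) ∨ (g ∧ e₂)) ∧ s)                  ≡⟨ 𝟙-∨ (e₁ ∧ h) (g ∧ e₂) s (disjoint c d) ⟩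
      𝟙 ((e₁ ∧ h) ∧ s) + 𝟙 ((g ∧ e₂) ∧ s)            ≡⟨ +-comm (𝟙 ((e₁ ∧ h) ∧ s)) _ ⟩
      𝟙 ((g ∧ e₂) ∧ s) + 𝟙 ((e₁ ∧ h) ∧ s)            ≡⟨ cong₂ _+_ (cong 𝟙 (trans (cong (_∧ s) (∧-comm g e₂)) (∧-assoc e₂ g s)))
                                                                  (cong 𝟙 (∧-assoc e₁ h s)) ⟩
      inLayer c d + inFibre c d                       ∎
      where
      s = t (combine c d)
      e₁ = ⌊ a F.≟ c ⌋
      e₂ = ⌊ b F.≟ d ⌋
      h = adj H b d
      g = adj G a c

next : ∀ {p} → Fin (suc p) → Fin (suc p)
next {p} i = fromℕ< (m%n<n (toℕ i + 1) (suc p))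

toℕ-next : ∀ {p} (i : Fin (suc p)) → toℕ (next i) ≡ (toℕ i + 1) % suc p
toℕ-next i = toℕ-fromℕ< _

next-inject₁ : ∀ {p} (j : Fin p) → next (inject₁ j) ≡ suc j
next-inject₁ {p} j = toℕ-injective (begin
  toℕ (next (inject₁ j))         ≡⟨ toℕ-next (inject₁ j) ⟩
  (toℕ (inject₁ j) + 1) % suc p  ≡⟨ cong (λ x → (x + 1) % suc p) (toℕ-inject₁ j) ⟩
  (toℕ j + 1) % suc p            ≡⟨ cong (_% suc p) (+-comm (toℕ j) 1) ⟩
  suc (toℕ j) % suc p            ≡⟨ m<n⇒m%n≡m (s≤s (toℕ<n j)) ⟩
  suc (toℕ j)                    ∎)
  where open ≡-Reasoning

next-fromℕ : ∀ {p} → next (fromℕ p) ≡ zero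
next-fromℕ {p} = toℕ-injective (begin
  toℕ (next (fromℕ p))         ≡⟨ toℕ-next (fromℕ p) ⟩
  (toℕ (fromℕ p) + 1) % suc p  ≡⟨ cong (λ x → (x + 1) % suc p) (toℕ-fromℕ p) ⟩
  (p + 1) % suc p              ≡⟨ cong (_% suc p) (+-comm p 1) ⟩
  suc p % suc p                ≡⟨ n%n≡0 (suc p) ⟩
  0                            ∎)
  where open ≡-Reasoning

next-injective : ∀ {p} {i j : Fin (suc p)} → next i ≡ next j → i ≡ j
next-injective {i = i} {j} eq with view i | view j
... | ‵fromℕ      | ‵fromℕ      = refl
... | ‵fromℕ      | ‵inject₁ j′ = contradiction (trans (sym next-fromℕ) (trans eq (next-inject₁ j′))) 0≢1+n
... | ‵inject₁ i′ | ‵fromℕ      = contradiction (trans (sym next-fromℕ) (trans (sym eq) (next-inject₁ i′))) 0≢1+n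
... | ‵inject₁ i′ | ‵inject₁ j′ =
  cong inject₁ (Fin-suc-injective (trans (sym (next-inject₁ i′)) (trans eq (next-inject₁ j′))))

∑-rotate : ∀ {p} (f : Fin (suc p) → ℕ) → ∑[ i < suc p ] f (next i) ≡ sum f
∑-rotate {p} f = begin
  ∑[ i < suc p ] f (next i)                              ≡⟨ sum-init-last (f ∘ next) ⟩
  ∑[ j < p ] f (next (inject₁ j)) + f (next (fromℕ p))  ≡⟨ cong₂ _+_ (sum-cong-≗ {p} (cong f ∘ next-inject₁)) (cong f next-fromℕ) ⟩
  ∑[ j < p ] f (suc j) + f zero                          ≡⟨ +-comm _ (f zero) ⟩
  sum f                                                  ∎
  where open ≡-Reasoning

cycle-next : ∀ {p} (i : Fin (suc p)) → adj (Cycle (suc p)) i (next i) ≡ true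
cycle-next {p} i with (toℕ i + 1) % suc p ℕ.≟ toℕ (next i)
... | yes _  = refl
... | no ≢   = contradiction (sym (toℕ-next i)) ≢

cycle-adj⇒next : ∀ {p} {i j : Fin (suc p)} → adj (Cycle (suc p)) i j ≡ true → next i ≡ j ⊎ next j ≡ i
cycle-adj⇒next {p} {i} {j} i~j with (toℕ i + 1) % suc p ℕ.≟ toℕ j | (toℕ j + 1) % suc p ℕ.≟ toℕ i
... | yes e | _     = inj₁ (toℕ-injective (trans (toℕ-next i) e))
... | no _  | yes e = inj₂ (toℕ-injective (trans (toℕ-next j) e))
... | no _  | no _  = contradiction i~j λ ()

module _ {p : ℕ} (X : Subset (suc p)) (i : Fin (suc p)) (next∉X : next i ∉ X) where

  δ-Cycle-≤1 : δ (Cycle (suc p)) X i ≤ 1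
  δ-Cycle-≤1 = all-equal⇒∣p∣≤1 (N (Cycle (suc p)) i ∩ X) λ j∈ k∈ → next-injective (trans (next≡i j∈) (sym (next≡i k∈)))
    where
    next≡i : ∀ {j} → j ∈ N (Cycle (suc p)) i ∩ X → next j ≡ i
    next≡i {j} j∈ with x∈p∩q⁻ (N (Cycle (suc p)) i) X j∈
    ... | j∈N , j∈X with cycle-adj⇒next {i = i} {j} (∈-tabulate⁻ {f = adj (Cycle (suc p)) i} j∈N)
    ...   | inj₁ next-i≡j = contradiction (subst (_∈ X) (sym next-i≡j) j∈X) next∉X
    ...   | inj₂ next-j≡i = next-j≡i

  δ-Cycle-∁>0 : 0 < δ (Cycle (suc p)) (∁ X) i
  δ-Cycle-∁>0 = x∈p⇒0<∣p∣ (x∈p∩q⁺ (∈-tabulate⁺ {f = adj (Cycle (suc p)) i} (cycle-next i) , x∉p⇒x∈∁p next∉X))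

module AdjacentLayers (G : Graph) (loopless : ∀ a → adj G a a ≡ false) {p : ℕ}
                      (S : Subset (order G * suc p)) (S-offensive : Offensive (G □ Cycle (suc p)) S) where
  open Grid (order G) (suc p)

  layer-offensive : ∀ i v → v ∉ layer S i → v ∉ layer S (next i) →
                    δ G (∁ (layer S i)) v + 1 ≤ δ G (layer S i) v
  layer-offensive i v v∉Sᵢ v∉Sᵢ₊₁ = +-cancelʳ-≤ 1 (δ G (∁ Sᵢ) v + 1) (δ G Sᵢ v) (begin
    δ G (∁ Sᵢ) v + 1 + 1                                    ≤⟨ +-monoˡ-≤ 1 (+-monoʳ-≤ (δ G (∁ Sᵢ) v) (δ-Cycle-∁>0 Sᵥ i next∉Sᵥ)) ⟩
    δ G (∁ Sᵢ) v + δ (Cycle (suc p)) (∁ Sᵥ) i + 1          ≤⟨ in-product ⟩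
    δ G Sᵢ v + δ (Cycle (suc p)) Sᵥ i                       ≤⟨ +-monoʳ-≤ (δ G Sᵢ v) (δ-Cycle-≤1 Sᵥ i next∉Sᵥ) ⟩
    δ G Sᵢ v + 1                                            ∎)
    where
    open ≤-Reasoning
    Sᵢ = layer S i
    Sᵥ = fibre S v
    next∉Sᵥ : next i ∉ Sᵥ
    next∉Sᵥ = v∉Sᵢ₊₁ ∘ ∈-tabulate⁺ ∘ ∈-tabulate⁻ {f = λ b → lookup S (combine v b)}
    in-product : δ G (∁ Sᵢ) v + δ (Cycle (suc p)) (∁ Sᵥ) i + 1 ≤ δ G Sᵢ v + δ (Cycle (suc p)) Sᵥ i
    in-product = subst₂ (λ l r → l + 1 ≤ r)
      (trans (δ-□ G (Cycle (suc p)) loopless (∁ S) v i)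
             (cong₂ _+_ (cong (λ T → δ G T v) (layer-∁ S i)) (cong (λ T → δ (Cycle (suc p)) T i) (fibre-∁ S v))))
      (δ-□ G (Cycle (suc p)) loopless S v i)
      (S-offensive (combine v i) (v∉Sᵢ ∘ ∈-tabulate⁺ ∘ []=⇒lookup))

  adjacent-layers : Fin (suc p) → Subset (order G)
  adjacent-layers i = layer S i ∪ layer S (next i)

  adjacent-layers-isGOA : Fin (order G) → ∀ i → IsGOA G (adjacent-layers i)
  adjacent-layers-isGOA v₀ i = offensive⇒nonempty G v₀ offensive , offensive
    where
    offensive : Offensive G (adjacent-layers i)
    offensive v v∉ = begin
      δ G (∁ (adjacent-layers i)) v + 1  ≤⟨ +-monoˡ-≤ 1 (δ-mono G v (p⊆q⇒∁p⊇∁q (p⊆p∪q (layer S (next i))))) ⟩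
      δ G (∁ (layer S i)) v + 1          ≤⟨ layer-offensive i v (v∉ ∘ x∈p∪q⁺ ∘ inj₁) (v∉ ∘ x∈p∪q⁺ ∘ inj₂) ⟩
      δ G (layer S i) v                  ≤⟨ δ-mono G v (p⊆p∪q (layer S (next i))) ⟩
      δ G (adjacent-layers i) v          ∎
      where open ≤-Reasoning

  ∑∣adjacent-layers∣≤2∣S∣ : ∑[ i < suc p ] ∣ adjacent-layers i ∣ ≤ ∣ S ∣ + ∣ S ∣
  ∑∣adjacent-layers∣≤2∣S∣ = begin
    ∑[ i < suc p ] ∣ adjacent-layers i ∣                           ≤⟨ ∑-mono-≤ (λ i → ∣p∪q∣≤∣p∣+∣q∣ (layer S i) (layer S (next i))) ⟩
    ∑[ i < suc p ] (∣ layer S i ∣ + ∣ layer S (next i) ∣)          ≡⟨ ∑-distrib-+ (λ i → ∣ layer S i ∣) (λ i → ∣ layer S (next i) ∣) ⟩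
    ∑[ i < suc p ] ∣ layer S i ∣ + ∑[ i < suc p ] ∣ layer S (next i) ∣ ≡⟨ cong (∑[ i < suc p ] ∣ layer S i ∣ +_) (∑-rotate (λ i → ∣ layer S i ∣)) ⟩
    ∑[ i < suc p ] ∣ layer S i ∣ + ∑[ i < suc p ] ∣ layer S i ∣     ≡⟨ cong₂ _+_ (∣T∣≡∑∣layer∣ S) (∣T∣≡∑∣layer∣ S) ⟨
    ∣ S ∣ + ∣ S ∣                                                  ∎
    where open ≤-Reasoning

ceilHalf-≤ : ∀ {a m} → a ≤ m + m → ceilHalf a ≤ m
ceilHalf-≤ {a} {m} a≤2m = s≤s⁻¹ (m<n*o⇒m/o<n (begin-strict
  a + 1        ≡⟨ +-comm a 1 ⟩
  suc a        <⟨ s≤s (s≤s a≤2m) ⟩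
  2 + (m + m)  ≡⟨ cong (λ x → 2 + (m + x)) (+-identityʳ m) ⟨
  2 + 2 * m    ≡⟨ cong (2 +_) (*-comm 2 m) ⟩
  suc m * 2    ∎))
  where open ≤-Reasoning

theorem7 : (G : Graph) → IsSimple G → Fin (order G) → (n : ℕ) → 3 ≤ n →
    (k m : ℕ) → IsGammaO G k → IsGammaO (G □ Cycle n) m →
    ceilHalf (n * k) ≤ m
theorem7 G (_ , loopless) v₀ (suc p) _ k m (_ , k-minimum) ((S , (_ , S-offensive) , ∣S∣≡m) , _) = ceilHalf-≤ (begin
  suc p * k                             ≡⟨ ∑-const (suc p) k ⟨
  ∑[ i < suc p ] k                      ≤⟨ ∑-mono-≤ (λ i → k-minimum (adjacent-layers i) (adjacent-layers-isGOA v₀ i)) ⟩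
  ∑[ i < suc p ] ∣ adjacent-layers i ∣  ≤⟨ ∑∣adjacent-layers∣≤2∣S∣ ⟩
  ∣ S ∣ + ∣ S ∣                         ≡⟨ cong₂ _+_ ∣S∣≡m ∣S∣≡m ⟩
  m + m                                 ∎)
  where
  open AdjacentLayers G loopless S S-offensive
  open ≤-Reasoning
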